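{- For all $k\ge1$, $n\ge0$ and $0\le q\le k$, we have $F_k^q(n+1)-F_k^q(n)=0$ if and only if $\mathrm{rank}_k(n)<q$. In particular $F_k(n+1)=F_k(n)$ if and only if $\mathrm{rank}_k(n)=0$.
   Context: For $k\ge1$, $F_k:\mathbb{N}\to\mathbb{N}$ is defined by $F_k(0)=0$ and $F_k(n)=n-F_k^k(n-1)$ for $n\ge1$, where $F_k^j$ denotes the $j$-th iterate of $F_k$ ($F_k^0$ is the identity). The sequence $(A_{k,p})_{p\ge0}$ is defined by $A_{k,p}=p+1$ for $0\le p<k$ and $A_{k,p}=A_{k,p-1}+A_{k,p-k}$ for $p\ge k$. For $n\ge0$, $D_k(n)$ denotes the unique finite set $D\subset\mathbb{N}$ whose elements are pairwise at distance at least $k$ and such that $\sum_{p\in D}A_{k,p}=n$. The $k$-rank $\mathrm{rank}_k(n)$ is the least element of $D_k(n)$, or $+\infty$ if $D_k(n)=\varnothing$ (i.e. $n=0$). -}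

module Defs where

open import Data.Nat using (ℕ; zero; suc; _+_; _∸_; _≤_; _<_; _≤ᵇ_; _<ᵇ_)
open import Data.Bool using (if_then_else_)
open import Data.List using (List; []; _∷_; map)
open import Data.Nat.ListAction using (sum)
open import Relation.Binary.PropositionalEquality using (_≡_)
open import Data.Product using (Σ; _×_; ∃)

iter : (ℕ → ℕ) → ℕ → ℕ → ℕ
iter f zero    x = x
iter f (suc j) x = f (iter f j x)

-- Ftab k n m = F_k(m) for m ≤ n (built from the values F_k(0..n-1));
-- the value for m > n is irrelevant.
Ftab : ℕ → ℕ → ℕ → ℕ
Ftab k zero    = λ _ → 0
Ftab k (suc n) = λ m → if m ≤ᵇ n then Ftab k n m
                        else suc n ∸ iter (Ftab k n) k n

-- F_k(0) = 0, F_k(n) = n - F_k^k(n-1)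
F : ℕ → ℕ → ℕ
F k n = Ftab k n n

-- Atab k p m = A_{k,m} for m ≤ p
Atab : ℕ → ℕ → ℕ → ℕ
Atab k zero    = λ _ → 1
Atab k (suc p) = λ m → if m ≤ᵇ p then Atab k p m
                        else (if suc p <ᵇ k then suc (suc p)
                              else Atab k p p + Atab k p (suc p ∸ k))

-- A_{k,p} = p+1 (p<k),  A_{k,p} = A_{k,p-1} + A_{k,p-k} (p ≥ k)
A : ℕ → ℕ → ℕ
A k p = Atab k p p

-- a finite set of naturals with pairwise distances ≥ k, listed in
-- increasing order: consecutive elements differ by at least k
data Spread (k : ℕ) : List ℕ → Set where
  nil  : Spread k []
  one  : ∀ x → Spread k (x ∷ [])
  cons : ∀ {x y ds} → x + k ≤ y → Spread k (y ∷ ds) → Spread k (x ∷ y ∷ ds)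

IsD : ℕ → ℕ → List ℕ → Set
IsD k n D = Spread k D × sum (map (A k) D) ≡ n

-- rank_k(n) < q : the least element of D_k(n) exists (n ≠ 0) and is < q
-- (the least element of the increasingly listed D is its head)
RankLt : ℕ → ℕ → ℕ → Set
RankLt k n q = Σ ℕ λ r → Σ (List ℕ) λ ds → IsD k n (r ∷ ds) × r < q

RankEq : ℕ → ℕ → ℕ → Set
RankEq k n r = Σ (List ℕ) λ ds → IsD k n (r ∷ ds)

-- Write n > 0 as a sum of A_{k,p} over a k-spread list D.  The key identity is
-- F_k(m + A_{k,p+1}) = F_k(m) + A_{k,p} for m ≤ A_{k,p+2-k}, proved by strong induction:
-- unfolding F_k(x+1) = x+1 - F_k^k(x) once, the induction hypothesis gives
-- F_k^j(m + A_{k,p+1}) = F_k^j(m) + A_{k,p+1-j} for j ≤ k, and A_{k,p+1} - A_{k,p+1-k} = A_{k,p}.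
-- Peeling D off from its least element, F_k lowers every index of D by one when min D > 0, so
-- it lowers a positive rank by one.  The increments of every F_k^q are 0 or 1; F_k^{q+1} is
-- flat at n (increment 0) iff F_k is flat at n or F_k^q is flat at F_k(n); and
-- F_k(n+2) - F_k(n+1) = 1 - (F_k^k(n+1) - F_k^k(n)).  A strong induction on n then shows that
-- F_k is flat exactly at rank 0, and an induction on q that F_k^q is flat exactly below rank q.
module Submission where

open import Defs
open import Data.Nat
  using ( ℕ; zero; suc; pred; _+_; _∸_; _≤_; _<_; _≤′_; ≤′-refl; ≤′-step; _≤ᵇ_; _<ᵇ_
        ; z≤n; s≤s; _≤?_; _<?_)
open import Data.Nat.Properties
open import Data.Nat.Induction using (<-rec; <-wellFounded)
open import Data.Bool using (if_then_else_)
open import Data.List using (List; []; _∷_; map)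
open import Data.Nat.ListAction using (sum)
open import Data.Product using (Σ; _×_; _,_)
open import Data.Sum using (_⊎_; inj₁; inj₂)
open import Data.Empty using (⊥-elim)
open import Function.Base using (_∘_)
open import Function.Bundles using (_⇔_; mk⇔; Equivalence)
open import Function.Properties.Equivalence using () renaming (refl to ⇔-refl; trans to ⇔-trans)
open import Induction.WellFounded using (Acc; acc)
open import Relation.Nullary using (¬_; contradiction; yes; no)
open import Relation.Nullary.Decidable using (dec-true; dec-false)
open import Relation.Binary.PropositionalEquality
open ≡-Reasoning

open Equivalence using (to; from)

if-≤ᵇ-then : ∀ {m n} {x y : ℕ} → m ≤ n → (if m ≤ᵇ n then x else y) ≡ x
if-≤ᵇ-then {m} {n} m≤n rewrite dec-true (m ≤? n) m≤n = refl

if-≤ᵇ-else : ∀ {m n} {x y : ℕ} → n < m → (if m ≤ᵇ n then x else y) ≡ y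
if-≤ᵇ-else {m} {n} n<m rewrite dec-false (m ≤? n) (<⇒≱ n<m) = refl

if-<ᵇ-then : ∀ {m n} {x y : ℕ} → m < n → (if m <ᵇ n then x else y) ≡ x
if-<ᵇ-then {m} {n} m<n rewrite dec-true (m <? n) m<n = refl

if-<ᵇ-else : ∀ {m n} {x y : ℕ} → n ≤ m → (if m <ᵇ n then x else y) ≡ y
if-<ᵇ-else {m} {n} n≤m rewrite dec-false (m <? n) (≤⇒≯ n≤m) = refl

extending-table-diagonal : (T : ℕ → ℕ → ℕ) → (∀ {n m} → m ≤ n → T (suc n) m ≡ T n m) →
                           ∀ {n m} → m ≤ n → T n m ≡ T m m
extending-table-diagonal T extends {zero}  z≤n = refl
extending-table-diagonal T extends {suc n} m≤1+n with m≤n⇒m<n∨m≡n m≤1+n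
... | inj₁ (s≤s m≤n) = trans (extends m≤n) (extending-table-diagonal T extends m≤n)
... | inj₂ refl      = refl

∸-∸-comm : ∀ m n o → m ∸ n ∸ o ≡ m ∸ o ∸ n
∸-∸-comm m n o = begin
  m ∸ n ∸ o   ≡⟨ ∸-+-assoc m n o ⟩
  m ∸ (n + o) ≡⟨ cong (m ∸_) (+-comm n o) ⟩
  m ∸ (o + n) ≡⟨ ∸-+-assoc m o n ⟨
  m ∸ o ∸ n   ∎

module _ {g : ℕ → ℕ} where

  mono-from-suc : (∀ n → g n ≤ g (suc n)) → ∀ {m n} → m ≤ n → g m ≤ g n
  mono-from-suc g≤g∘suc = go ∘ ≤⇒≤′
    where
    go : ∀ {m n} → m ≤′ n → g m ≤ g n
    go ≤′-refl     = ≤-refl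
    go (≤′-step p) = ≤-trans (go p) (g≤g∘suc _)

  iter-suc-inner : ∀ j x → iter g (suc j) x ≡ iter g j (g x)
  iter-suc-inner zero    x = refl
  iter-suc-inner (suc j) x = cong g (iter-suc-inner j x)

  iter-≤ : (∀ x → g x ≤ x) → ∀ j x → iter g j x ≤ x
  iter-≤ g≤id zero    x = ≤-refl
  iter-≤ g≤id (suc j) x = ≤-trans (g≤id _) (iter-≤ g≤id j x)

  iter-mono : (∀ {m n} → m ≤ n → g m ≤ g n) → ∀ j {m n} → m ≤ n → iter g j m ≤ iter g j n
  iter-mono g-mono zero    m≤n = m≤n
  iter-mono g-mono (suc j) m≤n = g-mono (iter-mono g-mono j m≤n)

UnitStep : (ℕ → ℕ) → ℕ → Set
UnitStep g x = g (suc x) ≡ g x ⊎ g (suc x) ≡ suc (g x)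

iter-unitStep : ∀ {g x} → (∀ y → g y ≤ y) → (∀ y → y ≤ x → UnitStep g y) →
                ∀ j → UnitStep (iter g j) x
iter-unitStep g≤id steps zero = inj₂ refl
iter-unitStep {g} {x} g≤id steps (suc j) with iter-unitStep g≤id steps j
... | inj₁ flat = inj₁ (cong g flat)
... | inj₂ rise rewrite rise = steps _ (iter-≤ g≤id j x)

Flat : ℕ → ℕ → ℕ → Set
Flat k j x = iter (F k) j (suc x) ≡ iter (F k) j x

module _ (k : ℕ) where

  Ftab-≤ : ∀ n m → Ftab k n m ≤ m
  Ftab-≤ zero    m = z≤n
  Ftab-≤ (suc n) m with m ≤? n
  ... | yes m≤n = ≤-trans (≤-reflexive (if-≤ᵇ-then m≤n)) (Ftab-≤ n m)
  ... | no  m≰n = ≤-trans (≤-reflexive (if-≤ᵇ-else (≰⇒> m≰n)))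
                          (≤-trans (m∸n≤m (suc n) (iter (Ftab k n) k n)) (≰⇒> m≰n))

  F-≤ : ∀ n → F k n ≤ n
  F-≤ n = Ftab-≤ n n

  Ftab≡F : ∀ {n m} → m ≤ n → Ftab k n m ≡ F k m
  Ftab≡F = extending-table-diagonal (Ftab k) if-≤ᵇ-then

  iter-Ftab≡iter-F : ∀ {n} j {x} → x ≤ n → iter (Ftab k n) j x ≡ iter (F k) j x
  iter-Ftab≡iter-F zero        x≤n = refl
  iter-Ftab≡iter-F (suc j) {x} x≤n rewrite iter-Ftab≡iter-F j x≤n =
    Ftab≡F (≤-trans (iter-≤ F-≤ j x) x≤n)

  F-suc : ∀ n → F k (suc n) ≡ suc n ∸ iter (F k) k n
  F-suc n = trans (if-≤ᵇ-else (n<1+n n)) (cong (suc n ∸_) (iter-Ftab≡iter-F k ≤-refl))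

  iter-F-0 : ∀ j → iter (F k) j 0 ≡ 0
  iter-F-0 zero    = refl
  iter-F-0 (suc j) = cong (F k) (iter-F-0 j)

  F-1 : F k 1 ≡ 1
  F-1 = trans (F-suc 0) (cong (1 ∸_) (iter-F-0 k))

  iter-F-1 : ∀ j → iter (F k) j 1 ≡ 1
  iter-F-1 zero    = refl
  iter-F-1 (suc j) = trans (cong (F k) (iter-F-1 j)) F-1

  mutual
    F-small : ∀ {x} → x < k → F k (suc (suc x)) ≡ suc x
    F-small {x} x<k =
      trans (F-suc (suc x)) (cong (suc (suc x) ∸_) (iter-F-small k x<k (<⇒≤ x<k)))

    iter-F-small : ∀ {x} j → x < k → x ≤ j → iter (F k) j (suc x) ≡ 1
    iter-F-small {zero}  j       _     _         = iter-F-1 j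
    iter-F-small {suc x} (suc j) 1+x<k (s≤s x≤j) = begin
      iter (F k) (suc j) (suc (suc x)) ≡⟨ iter-suc-inner j _ ⟩
      iter (F k) j (F k (suc (suc x))) ≡⟨ cong (iter (F k) j) (F-small x<k) ⟩
      iter (F k) j (suc x)             ≡⟨ iter-F-small j x<k x≤j ⟩
      1                                ∎
      where x<k = <-trans (n<1+n x) 1+x<k

  Flat-k⇒F-rises : ∀ {m} → Flat k k m → F k (suc (suc m)) ≡ suc (F k (suc m))
  Flat-k⇒F-rises {m} flat = begin
    F k (suc (suc m))                  ≡⟨ F-suc (suc m) ⟩
    suc (suc m) ∸ iter (F k) k (suc m) ≡⟨ cong (suc (suc m) ∸_) flat ⟩
    suc (suc m) ∸ iter (F k) k m       ≡⟨ +-∸-assoc 1 (≤-trans (iter-≤ F-≤ k m) (n≤1+n m)) ⟩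
    suc (suc m ∸ iter (F k) k m)       ≡⟨ cong suc (F-suc m) ⟨
    suc (F k (suc m))                  ∎

  rise-k⇒Flat-1 : ∀ {m} → iter (F k) k (suc m) ≡ suc (iter (F k) k m) → Flat k 1 (suc m)
  rise-k⇒Flat-1 {m} rise = begin
    F k (suc (suc m))                  ≡⟨ F-suc (suc m) ⟩
    suc (suc m) ∸ iter (F k) k (suc m) ≡⟨ cong (suc (suc m) ∸_) rise ⟩
    suc m ∸ iter (F k) k m             ≡⟨ F-suc m ⟨
    F k (suc m)                        ∎

  F-unitStep : ∀ n → UnitStep (F k) n
  F-unitStep = <-rec (UnitStep (F k)) step
    where
    step : ∀ n → (∀ {y} → y < n → UnitStep (F k) y) → UnitStep (F k) n
    step zero    _  = inj₂ F-1
    step (suc m) ih with iter-unitStep F-≤ (λ y y≤m → ih (s≤s y≤m)) k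
    ... | inj₁ flat = inj₂ (Flat-k⇒F-rises flat)
    ... | inj₂ rise = inj₁ (rise-k⇒Flat-1 rise)

  F-mono : ∀ {m n} → m ≤ n → F k m ≤ F k n
  F-mono = mono-from-suc F≤F∘suc
    where
    F≤F∘suc : ∀ n → F k n ≤ F k (suc n)
    F≤F∘suc n with F-unitStep n
    ... | inj₁ flat = ≤-reflexive (sym flat)
    ... | inj₂ rise = ≤-trans (n≤1+n _) (≤-reflexive (sym rise))

  ¬Flat-0 : ∀ j → ¬ Flat k j 0
  ¬Flat-0 j flat = 1+n≢0 (trans (sym (iter-F-1 j)) (trans flat (iter-F-0 j)))

  ¬Flat-1⇒rise : ∀ {n} → ¬ Flat k 1 n → F k (suc n) ≡ suc (F k n)
  ¬Flat-1⇒rise {n} ¬flat with F-unitStep n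
  ... | inj₁ flat = contradiction flat ¬flat
  ... | inj₂ rise = rise

  Flat-1-suc⇔¬Flat-k : ∀ {m} → Flat k 1 (suc m) ⇔ (¬ Flat k k m)
  Flat-1-suc⇔¬Flat-k {m} =
    mk⇔ (λ flat flat-k → 1+n≢n (trans (sym (Flat-k⇒F-rises flat-k)) flat)) rises
    where
    rises : ¬ Flat k k m → Flat k 1 (suc m)
    rises ¬flat-k with iter-unitStep F-≤ (λ y _ → F-unitStep y) k
    ... | inj₁ flat-k = contradiction flat-k ¬flat-k
    ... | inj₂ rise   = rise-k⇒Flat-1 rise

  Flat-1⇒Flat-suc : ∀ {n} q → Flat k 1 n → Flat k (suc q) n
  Flat-1⇒Flat-suc {n} q flat = begin
    iter (F k) (suc q) (suc n) ≡⟨ iter-suc-inner q (suc n) ⟩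
    iter (F k) q (F k (suc n)) ≡⟨ cong (iter (F k) q) flat ⟩
    iter (F k) q (F k n)       ≡⟨ iter-suc-inner q n ⟨
    iter (F k) (suc q) n       ∎

  Flat-suc⇔Flat-F : ∀ {n} q → F k (suc n) ≡ suc (F k n) → Flat k (suc q) n ⇔ Flat k q (F k n)
  Flat-suc⇔Flat-F {n} q rise
    rewrite iter-suc-inner {F k} q (suc n) | iter-suc-inner {F k} q n | rise = ⇔-refl

  A-table-suc : ∀ p → A k (suc p) ≡
                      (if suc p <ᵇ k then suc (suc p) else A k p + Atab k p (suc p ∸ k))
  A-table-suc p = if-≤ᵇ-else (n<1+n p)

  A-below-k : ∀ {p} → p < k → A k p ≡ suc p
  A-below-k {zero}  _     = refl
  A-below-k {suc p} 1+p<k = trans (A-table-suc p) (if-<ᵇ-then 1+p<k)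

  Atab≡A : ∀ {p m} → m ≤ p → Atab k p m ≡ A k m
  Atab≡A = extending-table-diagonal (Atab k) if-≤ᵇ-then

  Spread-lower-head : ∀ {r ds} → Spread k (suc r ∷ ds) → Spread k (r ∷ ds)
  Spread-lower-head (one _)       = one _
  Spread-lower-head (cons gap sp) = cons (≤-trans (n≤1+n _) gap) sp

  Spread-pred : ∀ {r ds} → Spread k (suc r ∷ ds) → Spread k (r ∷ map pred ds)
  Spread-pred (one _)                         = one _
  Spread-pred (cons {y = suc _} (s≤s gap) sp) = cons gap (Spread-pred sp)

module _ {k : ℕ} (k≥1 : 1 ≤ k) where

  A-suc : ∀ p → A k (suc p) ≡ A k p + A k (suc p ∸ k)
  A-suc p with suc p <? k
  ... | yes 1+p<k = begin
    A k (suc p)             ≡⟨ A-below-k k 1+p<k ⟩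
    suc (suc p)             ≡⟨ +-comm 1 (suc p) ⟩
    suc p + 1               ≡⟨ cong₂ _+_ (A-below-k k (<-trans (n<1+n p) 1+p<k))
                                         (cong (A k) (m≤n⇒m∸n≡0 (<⇒≤ 1+p<k))) ⟨
    A k p + A k (suc p ∸ k) ∎
  ... | no 1+p≮k = begin
    A k (suc p)                  ≡⟨ A-table-suc k p ⟩
    _                            ≡⟨ if-<ᵇ-else (≮⇒≥ 1+p≮k) ⟩
    A k p + Atab k p (suc p ∸ k) ≡⟨ cong (A k p +_) (Atab≡A k (∸-monoʳ-≤ (suc p) k≥1)) ⟩
    A k p + A k (suc p ∸ k)      ∎

  A-small : ∀ {p} → p ≤ k → A k p ≡ suc p
  A-small {zero}  _     = refl
  A-small {suc p} 1+p≤k = begin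
    A k (suc p)             ≡⟨ A-suc p ⟩
    A k p + A k (suc p ∸ k) ≡⟨ cong₂ _+_ (A-small (<⇒≤ 1+p≤k)) (cong (A k) (m≤n⇒m∸n≡0 1+p≤k)) ⟩
    suc p + 1               ≡⟨ +-comm (suc p) 1 ⟩
    suc (suc p)             ∎

  A-suc-small : ∀ {p} → suc p ≤ k → A k (suc p) ≡ suc (A k p)
  A-suc-small 1+p≤k = trans (A-small 1+p≤k) (cong suc (sym (A-small (<⇒≤ 1+p≤k))))

  A-mono : ∀ {p q} → p ≤ q → A k p ≤ A k q
  A-mono = mono-from-suc (λ p → ≤-trans (m≤m+n _ _) (≤-reflexive (sym (A-suc p))))

  A-pos : ∀ p → 0 < A k p
  A-pos p = A-mono {0} {p} z≤n

  F-A-small : ∀ {p} → suc p ≤ k → F k (A k (suc p)) ≡ A k p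
  F-A-small {p} 1+p≤k = begin
    F k (A k (suc p)) ≡⟨ cong (F k) (A-small 1+p≤k) ⟩
    F k (suc (suc p)) ≡⟨ F-small k 1+p≤k ⟩
    suc p             ≡⟨ A-small (<⇒≤ 1+p≤k) ⟨
    A k p             ∎

  F-suc+A-small : ∀ {p m} → suc p < k → suc m ≤ A k (suc (suc p) ∸ k) →
                  F k (suc m + A k (suc p)) ≡ F k (suc m) + A k p
  F-suc+A-small {p} {zero} 2+p≤k _ = begin
    F k (suc (A k (suc p))) ≡⟨ cong (F k ∘ suc) (A-small (<⇒≤ 2+p≤k)) ⟩
    F k (suc (suc (suc p))) ≡⟨ F-small k 2+p≤k ⟩
    suc (suc p)             ≡⟨ cong₂ _+_ (F-1 k) (A-small (<⇒≤ (<⇒≤ 2+p≤k))) ⟨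
    F k 1 + A k p           ∎
  F-suc+A-small {p} {suc m} 2+p≤k 2+m≤A =
    contradiction (≤-pred (≤-trans 2+m≤A (≤-reflexive (cong (A k) (m≤n⇒m∸n≡0 2+p≤k))))) λ ()

  Shifts : ℕ → Set
  Shifts n = ∀ p m → m + A k (suc p) ≡ n → m ≤ A k (suc (suc p) ∸ k) → F k n ≡ F k m + A k p

  module ShiftsBelow {n : ℕ} (ih : ∀ {y} → y < n → Shifts y) where

    F-A : ∀ i → A k i < n → F k (A k i) ≡ A k (pred i)
    F-A zero    _   = F-1 k
    F-A (suc i) A<n = ih A<n i 0 refl z≤n

    iter-F-A : ∀ j i → A k i < n → iter (F k) j (A k i) ≡ A k (i ∸ j)
    iter-F-A zero    i _   = refl
    iter-F-A (suc j) i A<n = begin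
      F k (iter (F k) j (A k i)) ≡⟨ cong (F k) (iter-F-A j i A<n) ⟩
      F k (A k (i ∸ j))          ≡⟨ F-A (i ∸ j) (≤-<-trans (A-mono (m∸n≤m i j)) A<n) ⟩
      A k (pred (i ∸ j))         ≡⟨ cong (A k) (pred[m∸n]≡m∸[1+n] i j) ⟩
      A k (i ∸ suc j)            ∎

    iter-F-+A : ∀ {p m} → k ≤ suc p → m < A k (suc (suc p) ∸ k) → m + A k (suc p) < n →
                ∀ j → j ≤ k → iter (F k) j (m + A k (suc p)) ≡ iter (F k) j m + A k (suc p ∸ j)
    iter-F-+A _ _ _ zero _ = refl
    iter-F-+A {p} {m} k≤1+p m<bound x<n (suc j) 1+j≤k = begin
      F k (iter (F k) j (m + A k (suc p))) ≡⟨ cong (F k) (iter-F-+A k≤1+p m<bound x<n j j≤k) ⟩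
      F k (y + A k (suc p ∸ j))            ≡⟨ cong (λ i → F k (y + A k i)) (+-∸-assoc 1 j≤p) ⟩
      F k (y + A k (suc (p ∸ j)))          ≡⟨ ih y+A<n (p ∸ j) y refl y≤bound ⟩
      F k y + A k (p ∸ j)                  ∎
      where
      y = iter (F k) j m
      j≤k = <⇒≤ 1+j≤k
      j≤p : j ≤ p
      j≤p = ≤-pred (≤-trans 1+j≤k k≤1+p)
      y+A<n : y + A k (suc (p ∸ j)) < n
      y+A<n = ≤-<-trans (+-mono-≤ (iter-≤ (F-≤ k) j m) (A-mono (s≤s (m∸n≤m p j)))) x<n
      bound<n : A k (suc (suc p) ∸ k) < n
      bound<n = ≤-<-trans (≤-trans (A-mono (∸-monoʳ-≤ (suc (suc p)) k≥1)) (m≤n+m _ m)) x<n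
      index : suc (suc p) ∸ k ∸ j ≡ suc (suc (p ∸ j)) ∸ k
      index = trans (∸-∸-comm (suc (suc p)) k j) (cong (_∸ k) (+-∸-assoc 2 j≤p))
      y≤bound : y ≤ A k (suc (suc (p ∸ j)) ∸ k)
      y≤bound = ≤-trans (iter-mono (F-mono k) j (<⇒≤ m<bound))
                        (≤-reflexive (trans (iter-F-A j _ bound<n) (cong (A k) index)))

    F-+A : ∀ {p m} → k ≤ suc p → 0 < m → m ≤ A k (suc (suc p) ∸ k) → m + A k (suc p) ≤ n →
           F k (m + A k (suc p)) ≡ F k m + A k p
    F-+A {p} {suc m} k≤1+p _ m<bound x<n = begin
      F k (suc x)                     ≡⟨ F-suc k x ⟩
      suc x ∸ iter (F k) k x          ≡⟨ cong (suc x ∸_) (iter-F-+A k≤1+p m<bound x<n k ≤-refl) ⟩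
      suc (m + A k (suc p)) ∸ (Y + B) ≡⟨ cong (λ a → suc (m + a) ∸ (Y + B)) (A-suc p) ⟩
      suc m + (A k p + B) ∸ (Y + B)   ≡⟨ cong (_∸ (Y + B)) (+-assoc (suc m) _ B) ⟨
      suc m + A k p + B ∸ (Y + B)     ≡⟨ cong₂ _∸_ (+-comm _ B) (+-comm Y B) ⟩
      B + (suc m + A k p) ∸ (B + Y)   ≡⟨ [m+n]∸[m+o]≡n∸o B _ Y ⟩
      suc m + A k p ∸ Y               ≡⟨ +-∸-comm (A k p) Y≤1+m ⟩
      suc m ∸ Y + A k p               ≡⟨ cong (_+ A k p) (F-suc k m) ⟨
      F k (suc m) + A k p             ∎
      where
      x = m + A k (suc p)
      Y = iter (F k) k m
      B = A k (suc p ∸ k)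
      Y≤1+m : Y ≤ suc m
      Y≤1+m = ≤-trans (iter-≤ (F-≤ k) k m) (n≤1+n m)

    F-A-large : ∀ {p} → k ≤ p → A k (suc p) ≤ n → F k (A k (suc p)) ≡ A k p
    F-A-large {zero}  k≤0   _   = contradiction (≤-trans k≥1 k≤0) λ ()
    F-A-large {suc p} k≤1+p A≤n = begin
      F k (A k (suc (suc p)))  ≡⟨ cong (F k) A-split ⟩
      F k (B + A k (suc p))    ≡⟨ F-+A k≤1+p (A-pos i) ≤-refl (≤-trans (≤-reflexive (sym A-split)) A≤n) ⟩
      F k B + A k p            ≡⟨ cong (_+ A k p) (F-A i B<n) ⟩
      A k (pred i) + A k p     ≡⟨ cong (λ i′ → A k i′ + A k p) (pred[m∸n]≡m∸[1+n] (suc (suc p)) k) ⟩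
      A k (suc p ∸ k) + A k p  ≡⟨ +-comm _ (A k p) ⟩
      A k p + A k (suc p ∸ k)  ≡⟨ A-suc p ⟨
      A k (suc p)              ∎
      where
      i = suc (suc p) ∸ k
      B = A k i
      A-split : A k (suc (suc p)) ≡ B + A k (suc p)
      A-split = trans (A-suc (suc p)) (+-comm _ B)
      B<n : B < n
      B<n = <-≤-trans (m<m+n B (A-pos (suc p))) (≤-trans (≤-reflexive (sym A-split)) A≤n)

  shifts : ∀ n → Shifts n
  shifts = <-rec Shifts step
    where
    step : ∀ n → (∀ {y} → y < n → Shifts y) → Shifts n
    step _ ih p zero    refl _ with suc p ≤? k
    ... | yes 1+p≤k = F-A-small 1+p≤k
    ... | no  1+p≰k = ShiftsBelow.F-A-large ih (≤-pred (≰⇒> 1+p≰k)) ≤-refl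
    step _ ih p (suc m) refl m<bound with k ≤? suc p
    ... | yes k≤1+p = ShiftsBelow.F-+A ih k≤1+p (s≤s z≤n) m<bound ≤-refl
    ... | no  k≰1+p = F-suc+A-small (≰⇒> k≰1+p) m<bound

  val : List ℕ → ℕ
  val ds = sum (map (A k) ds)

  F-val : ∀ {x xs} m → Spread k (suc x ∷ xs) → m < A k (suc (suc x) ∸ k) →
          F k (m + val (suc x ∷ xs)) ≡ F k m + val (x ∷ map pred xs)
  F-val {x} m (one _) m<bound
    rewrite +-identityʳ (A k (suc x)) | +-identityʳ (A k x) = shifts _ x m refl (<⇒≤ m<bound)
  F-val {x} m (cons {y = suc y} {ds} (s≤s x+k≤y) sp) m<bound = begin
    F k (m + (A k (suc x) + val (suc y ∷ ds)))    ≡⟨ cong (F k) (+-assoc m _ _) ⟨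
    F k (m + A k (suc x) + val (suc y ∷ ds))      ≡⟨ F-val (m + A k (suc x)) sp m+A<bound′ ⟩
    F k (m + A k (suc x)) + val (y ∷ map pred ds) ≡⟨ cong (_+ _) (shifts _ x m refl (<⇒≤ m<bound)) ⟩
    F k m + A k x + val (y ∷ map pred ds)         ≡⟨ +-assoc (F k m) _ _ ⟩
    F k m + (A k x + val (y ∷ map pred ds))       ∎
    where
    2+x≤2+y∸k : suc (suc x) ≤ suc (suc y) ∸ k
    2+x≤2+y∸k = ≤-trans (≤-reflexive (sym (m+n∸n≡m (suc (suc x)) k)))
                        (∸-monoˡ-≤ k (s≤s (s≤s x+k≤y)))
    m+A<bound′ : m + A k (suc x) < A k (suc (suc y) ∸ k)
    m+A<bound′ = <-≤-trans (+-monoˡ-< (A k (suc x)) m<bound)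
      (≤-trans (≤-reflexive (trans (+-comm _ (A k (suc x))) (sym (A-suc (suc x)))))
               (A-mono 2+x≤2+y∸k))

  ¬RankEq-0 : ∀ {r} → ¬ RankEq k 0 r
  ¬RankEq-0 {r} (_ , _ , sum≡0) = <⇒≢ (A-pos r) (sym (m+n≡0⇒m≡0 (A k r) sum≡0))

  RankEq-F : ∀ {n r} → RankEq k n (suc r) → RankEq k (F k n) r
  RankEq-F {r = r} (ds , sp , refl) =
    map pred ds , Spread-pred k sp , sym (F-val 0 sp (A-pos (suc (suc r) ∸ k)))

  rank-0⇒pred-rank≥k : ∀ {m} → RankEq k (suc m) 0 → m ≡ 0 ⊎ Σ ℕ λ d → k ≤ d × RankEq k m d
  rank-0⇒pred-rank≥k ([]     , one _       , eq) = inj₁ (sym (suc-injective eq))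
  rank-0⇒pred-rank≥k (d ∷ ds , cons k≤d sp , eq) = inj₂ (d , k≤d , ds , sp , suc-injective eq)

  -- The head index is r + 1 while the gap condition is only asked of r: splitting
  -- A_{r+1} = A_r + A_{r+1-k} puts r + 1 - k at distance k - 1 below r.
  pred-rank<k-acc : ∀ {m r ds} → Acc _<_ r → Spread k (r ∷ ds) → A k (suc r) + val ds ≡ suc m →
                    Σ ℕ λ h → h < k × RankEq k m h
  pred-rank<k-acc {m} {r} {ds} (acc below) sp eq with suc r ≤? k
  ... | yes r<k =
    r , r<k , ds , sp , suc-injective (trans (cong (_+ val ds) (sym (A-suc-small r<k))) eq)
  ... | no  r≮k = pred-rank<k-acc (below (∸-monoʳ-< k≥1 k≤r)) (cons (≤-reflexive (m∸n+n≡m k≤r)) sp)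
    (begin
      A k (suc (r ∸ k)) + (A k r + val ds) ≡⟨ +-assoc (A k (suc (r ∸ k))) _ _ ⟨
      A k (suc (r ∸ k)) + A k r + val ds   ≡⟨ cong (_+ val ds) (+-comm _ (A k r)) ⟩
      A k r + A k (suc (r ∸ k)) + val ds   ≡⟨ cong (λ i → A k r + A k i + val ds) (+-∸-assoc 1 k≤r) ⟨
      A k r + A k (suc r ∸ k) + val ds     ≡⟨ cong (_+ val ds) (A-suc r) ⟨
      A k (suc r) + val ds                 ≡⟨ eq ⟩
      suc m                                ∎)
    where
    k≤r : k ≤ r
    k≤r = ≤-pred (≰⇒> r≮k)

  rank>0⇒pred-rank<k : ∀ {m r} → RankEq k (suc m) (suc r) → Σ ℕ λ h → h < k × RankEq k m h
  rank>0⇒pred-rank<k {r = r} (ds , sp , eq) =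
    pred-rank<k-acc (<-wellFounded r) (Spread-lower-head k sp) eq

  -- As in pred-rank<k-acc, the head r + 1 may sit at distance k - 1 below the next index d;
  -- then A_{r+1} + A_d = A_{d+1} and the carry moves up.
  carry : ∀ {n} r ds → Spread k (r ∷ ds) → A k (suc r) + val ds ≡ n → Σ ℕ (RankEq k n)
  carry r []       _               eq = suc r , [] , one (suc r) , eq
  carry r (d ∷ ds) (cons r+k≤d sp) eq with suc r + k ≤? d
  ... | yes 1+r+k≤d = suc r , d ∷ ds , cons 1+r+k≤d sp , eq
  ... | no  1+r+k≰d with refl ← ≤-antisym r+k≤d (≤-pred (≰⇒> 1+r+k≰d)) =
    carry (r + k) ds sp (begin
      A k (suc (r + k)) + val ds                   ≡⟨ cong (_+ val ds) (A-suc (r + k)) ⟩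
      A k (r + k) + A k (suc (r + k) ∸ k) + val ds ≡⟨ cong (λ i → A k (r + k) + A k i + val ds)
                                                           (m+n∸n≡m (suc r) k) ⟩
      A k (r + k) + A k (suc r) + val ds           ≡⟨ cong (_+ val ds) (+-comm (A k (r + k)) _) ⟩
      A k (suc r) + A k (r + k) + val ds           ≡⟨ +-assoc (A k (suc r)) _ _ ⟩
      A k (suc r) + (A k (r + k) + val ds)         ≡⟨ eq ⟩
      _                                            ∎)

  rank-exists : ∀ m → Σ ℕ (RankEq k (suc m))
  rank-exists zero = 0 , [] , one 0 , refl
  rank-exists (suc m) with rank-exists m
  ... | r , ds , sp , eq with k ≤? r
  ...   | yes k≤r = 0 , r ∷ ds , cons k≤r sp , cong suc eq
  ...   | no  k≰r =
    carry r ds sp (trans (cong (_+ val ds) (A-suc-small (≰⇒> k≰r))) (cong suc eq))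

  Rank0⇔Flat : ℕ → Set
  Rank0⇔Flat n = ∀ {r} → RankEq k n r → Flat k 1 n ⇔ r ≡ 0

  Flat⇔rank< : ∀ q {n r} → RankEq k n r → (∀ {y} → y ≤ n → Rank0⇔Flat y) → Flat k q n ⇔ r < q
  Flat⇔rank< zero _ _ = mk⇔ (λ flat → contradiction flat 1+n≢n) λ ()
  Flat⇔rank< (suc q) {r = zero} rk criterion =
    mk⇔ (λ _ → s≤s z≤n) (λ _ → Flat-1⇒Flat-suc k q (criterion ≤-refl rk .from refl))
  Flat⇔rank< (suc q) {n} {suc r} rk criterion =
    ⇔-trans (Flat-suc⇔Flat-F k q rise)
      (⇔-trans (Flat⇔rank< q (RankEq-F rk) (λ y≤Fn → criterion (≤-trans y≤Fn (F-≤ k n))))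
               (mk⇔ s≤s ≤-pred))
    where
    rise : F k (suc n) ≡ suc (F k n)
    rise = ¬Flat-1⇒rise k {n} (λ flat → 1+n≢0 (criterion ≤-refl rk .to flat))

  rank0⇔Flat : ∀ n → Rank0⇔Flat n
  rank0⇔Flat = <-rec Rank0⇔Flat step
    where
    step : ∀ n → (∀ {y} → y < n → Rank0⇔Flat y) → Rank0⇔Flat n
    step zero    _  rk = contradiction rk ¬RankEq-0
    step (suc m) ih {zero} rk =
      mk⇔ (λ _ → refl) (λ _ → Flat-1-suc⇔¬Flat-k k .from (¬Flat-k (rank-0⇒pred-rank≥k rk)))
      where
      ¬Flat-k : (m ≡ 0 ⊎ Σ ℕ λ d → k ≤ d × RankEq k m d) → ¬ Flat k k m
      ¬Flat-k (inj₁ refl)                 = ¬Flat-0 k k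
      ¬Flat-k (inj₂ (d , k≤d , rk′)) flat = <⇒≱ (Flat⇔rank< k rk′ (ih ∘ s≤s) .to flat) k≤d
    step (suc m) ih {suc r} rk with rank>0⇒pred-rank<k rk
    ... | h , h<k , rk′ = mk⇔ (λ flat → ⊥-elim (Flat-1-suc⇔¬Flat-k k .to flat flat-k)) λ ()
      where
      flat-k : Flat k k m
      flat-k = Flat⇔rank< k rk′ (ih ∘ s≤s) .from h<k

  Flat⇔RankLt : ∀ n q → Flat k q n ⇔ RankLt k n q
  Flat⇔RankLt n q = mk⇔ (flat⇒rank< n) λ (r , ds , isD , r<q) → Flat⇔rank<′ (ds , isD) .from r<q
    where
    Flat⇔rank<′ : ∀ {n r} → RankEq k n r → Flat k q n ⇔ r < q
    Flat⇔rank<′ rk = Flat⇔rank< q rk (λ _ → rank0⇔Flat _)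
    flat⇒rank< : ∀ n → Flat k q n → RankLt k n q
    flat⇒rank< zero    flat = contradiction flat (¬Flat-0 k q)
    flat⇒rank< (suc m) flat with rank-exists m
    ... | r , ds , isD = r , ds , isD , Flat⇔rank<′ (ds , isD) .to flat

RankLt-1⇔RankEq-0 : ∀ {k n} → RankLt k n 1 ⇔ RankEq k n 0
RankLt-1⇔RankEq-0 = mk⇔ (λ { (zero , ds , isD , _) → ds , isD ; (suc _ , _ , _ , s≤s ()) })
                        (λ (ds , isD) → 0 , ds , isD , s≤s z≤n)

theorem4p11 : (k : ℕ) → 1 ≤ k →
    ((n q : ℕ) → q ≤ k →
      (iter (F k) q (suc n) ≡ iter (F k) q n) ⇔ RankLt k n q)
    × ((n : ℕ) → (F k (suc n) ≡ F k n) ⇔ RankEq k n 0)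
theorem4p11 k k≥1 =
  (λ n q _ → Flat⇔RankLt k≥1 n q) ,
  (λ n → ⇔-trans (Flat⇔RankLt k≥1 n 1) RankLt-1⇔RankEq-0)
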